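{- Say a word $\sigma=\sigma_1\cdots\sigma_n$ over $\{1,\dots,k\}$ avoids $13\text{ - }2$ if there are no indices $i,j$ with $j>i+1$ and $\sigma_i<\sigma_j<\sigma_{i+1}$, and let $F_{13\text{ - }2}(x;k)=\sum_{n\ge0}f_{13\text{ - }2}(n,k)x^n$, where $f_{13\text{ - }2}(n,k)$ is the number of such words of length $n$. Then \[ F_{13\text{ - }2}(x;1)=\frac{1}{1-x},\quad F_{13\text{ - }2}(x;2)=\frac{1}{1-2x},\quad F_{13\text{ - }2}(x;3)=\frac{(1-x)^2}{(1-2x)(1-3x+x^2)}, \] \[ F_{13\text{ - }2}(x;4)=\frac{1-4x+6x^2-3x^3}{(1-3x)(1-2x)(1-3x+x^2)}. \]
   Context: The empty word (length $0$) is counted once. -}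

module Defs where

open import Data.Nat as ℕ using (ℕ; zero; suc; _∸_)
import Data.Nat.Properties as ℕP
open import Data.Fin as Fin using (Fin; toℕ)
import Data.Fin.Properties as FinP
open import Data.Vec using (Vec; []; _∷_; lookup)
open import Data.List using (List; []; _∷_; map; concatMap; allFin; filter; length)
open import Data.Integer as ℤ using (ℤ; +_)
open import Data.Product using (Σ; _×_; _,_; ∃)
open import Relation.Nullary using (¬_; Dec; ¬?)
open import Relation.Nullary.Decidable using (_×-dec_)
open import Relation.Binary.PropositionalEquality using (_≡_)

-- Words of length n over the alphabet {1,…,k}, the letter i+1 being
-- represented by (i : Fin k); the order on letters is the order on Fin k.
Word : ℕ → ℕ → Set
Word k n = Vec (Fin k) n

Occ13-2 : ∀ {k n} → Word k n → Set
Occ13-2 {k} {n} σ =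
  Σ (Fin n) λ i → Σ (Fin n) λ i' → Σ (Fin n) λ j →
    (toℕ i' ≡ suc (toℕ i)) × (suc (toℕ i) ℕ.< toℕ j) ×
    (lookup σ i Fin.< lookup σ j) × (lookup σ j Fin.< lookup σ i')

Avoids13-2 : ∀ {k n} → Word k n → Set
Avoids13-2 σ = ¬ Occ13-2 σ

occ13-2? : ∀ {k n} (σ : Word k n) → Dec (Occ13-2 σ)
occ13-2? σ =
  FinP.any? λ i → FinP.any? λ i' → FinP.any? λ j →
    (toℕ i' ℕP.≟ suc (toℕ i)) ×-dec (suc (toℕ i) ℕP.<? toℕ j) ×-dec
    (lookup σ i FinP.<? lookup σ j) ×-dec (lookup σ j FinP.<? lookup σ i')

avoids13-2? : ∀ {k n} (σ : Word k n) → Dec (Avoids13-2 σ)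
avoids13-2? σ = ¬? (occ13-2? σ)

allWords : (k n : ℕ) → List (Word k n)
allWords k zero    = [] ∷ []
allWords k (suc n) = concatMap (λ a → map (a ∷_) (allWords k n)) (allFin k)

f13-2 : ℕ → ℕ → ℕ
f13-2 n k = length (filter avoids13-2? (allWords k n))

FPS : Set
FPS = ℕ → ℤ

F13-2 : ℕ → FPS
F13-2 k n = + f13-2 n k

sumTo : (ℕ → ℤ) → ℕ → ℤ
sumTo h zero    = h zero
sumTo h (suc n) = sumTo h n ℤ.+ h (suc n)

infixl 7 _⋆_
_⋆_ : FPS → FPS → FPS
(f ⋆ g) n = sumTo (λ i → f i ℤ.* g (n ∸ i)) n

poly : List ℤ → FPS
poly []       n       = + 0
poly (c ∷ cs) zero    = c
poly (c ∷ cs) (suc n) = poly cs n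

infix 4 _≈ₛ_
_≈ₛ_ : FPS → FPS → Set
f ≈ₛ g = ∀ n → f n ≡ g n

-- Whether a letter a can be prepended to a 13-2-avoiding word w without creating
-- an occurrence depends only on the first letter b of w and the set S of letters
-- after it: a is blocked iff some c ∈ S has a < c < b. Hence f_{13-2}(n,k) is (Tⁿ 1)
-- at the state of the empty word, for a linear transfer operator T on functions of
-- these finitely many states.
-- For a linear T, the sequence m ↦ Σᵢ qᵢ Tᵐ⁺ᵈ⁻ⁱ1 is itself an orbit of T, so it is
-- constant once its value at m = 0 is a fixed point of T; checking this at every
-- state shows that f satisfies the recurrence with characteristic polynomial the
-- claimed denominator, and the first coefficients of the product give the numerator.

module Submission where

open import Defs
open import Data.Nat as ℕ using (ℕ; zero; suc; _∸_; _≤_; _<?_)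
import Data.Nat.Properties as ℕ
open import Data.Nat.GeneralisedArithmetic using (fold; iterate; iterate-is-fold)
open import Data.Fin as Fin using (Fin)
import Data.Fin.Properties as Fin
open import Data.Fin.Subset using (Subset; _∈_; ⁅_⁆; _∪_) renaming (⊥ to ∅)
open import Data.Fin.Subset.Properties
  using (_∈?_; x∈⁅x⁆; x∈⁅y⁆⇒x≡y; p⊆p∪q; q⊆p∪q; x∈p∪q⁻; ∉⊥; anySubset?)
open import Data.Vec using ([]; _∷_; lookup)
open import Data.List using (List; []; _∷_; _++_; map; concatMap; filter; length; upTo; allFin)
open import Data.List.Relation.Unary.All as All using (All; []; _∷_)
open import Data.List.Membership.Propositional.Properties using (∈-upTo⁺)
open import Data.Bool using (Bool; true; false; if_then_else_; not; _∧_)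
open import Data.Maybe using (Maybe; just; nothing)
open import Data.Product using (_×_; _,_; ∃-syntax)
open import Data.Sum using (_⊎_; inj₁; inj₂; [_,_])
open import Data.Empty using (⊥; ⊥-elim)
open import Data.Integer using (ℤ; +_; -_; 0ℤ; 1ℤ; _+_; _*_)
import Data.Integer.Properties as ℤ
open import Algebra.Properties.CommutativeSemigroup ℤ.+-commutativeSemigroup using (interchange)
open import Function using (_⇔_; mk⇔; _∘_)
open import Relation.Nullary using (¬_; Dec; yes; no; does; ¬?)
open import Relation.Nullary.Decidable using (map′; _×-dec_; does-⇔; decidable-stable; True; toWitness)
open import Relation.Unary using (Decidable)
import Relation.Binary.Reasoning.Setoid
open import Relation.Binary.PropositionalEquality using (_≡_; refl; sym; trans; cong; cong₂; _→-setoid_; module ≡-Reasoning)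

private variable
  A B : Set
  k n : ℕ

∑ : List A → (A → ℤ) → ℤ
∑ []       f = 0ℤ
∑ (x ∷ xs) f = f x + ∑ xs f

∑-cong : ∀ (xs : List A) {f g : A → ℤ} → (∀ x → f x ≡ g x) → ∑ xs f ≡ ∑ xs g
∑-cong []       f≗g = refl
∑-cong (x ∷ xs) f≗g = cong₂ _+_ (f≗g x) (∑-cong xs f≗g)

∑-0 : ∀ (xs : List A) → ∑ xs (λ _ → 0ℤ) ≡ 0ℤ
∑-0 []       = refl
∑-0 (x ∷ xs) = trans (ℤ.+-identityˡ _) (∑-0 xs)

∑-++ : ∀ (xs ys : List A) (f : A → ℤ) → ∑ (xs ++ ys) f ≡ ∑ xs f + ∑ ys f
∑-++ []       ys f = sym (ℤ.+-identityˡ _)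
∑-++ (x ∷ xs) ys f = trans (cong (_+_ (f x)) (∑-++ xs ys f)) (sym (ℤ.+-assoc (f x) _ _))

∑-+ : ∀ (xs : List A) (f g : A → ℤ) → ∑ xs (λ x → f x + g x) ≡ ∑ xs f + ∑ xs g
∑-+ []       f g = refl
∑-+ (x ∷ xs) f g = trans (cong (_+_ (f x + g x)) (∑-+ xs f g)) (interchange (f x) (g x) _ _)

∑-*ˡ : ∀ (xs : List A) (c : ℤ) (f : A → ℤ) → ∑ xs (λ x → c * f x) ≡ c * ∑ xs f
∑-*ˡ []       c f = sym (ℤ.*-zeroʳ c)
∑-*ˡ (x ∷ xs) c f = trans (cong (_+_ (c * f x)) (∑-*ˡ xs c f)) (sym (ℤ.*-distribˡ-+ c (f x) _))

∑-map : (h : A → B) (xs : List A) (f : B → ℤ) → ∑ (map h xs) f ≡ ∑ xs (λ x → f (h x))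
∑-map h []       f = refl
∑-map h (x ∷ xs) f = cong (_+_ (f (h x))) (∑-map h xs f)

∑-concatMap : (g : A → List B) (xs : List A) (f : B → ℤ) →
              ∑ (concatMap g xs) f ≡ ∑ xs (λ x → ∑ (g x) f)
∑-concatMap g []       f = refl
∑-concatMap g (x ∷ xs) f = trans (∑-++ (g x) _ f) (cong (_+_ (∑ (g x) f)) (∑-concatMap g xs f))

∑-comm : (xs : List A) (ys : List B) (f : A → B → ℤ) →
         ∑ xs (λ x → ∑ ys (f x)) ≡ ∑ ys (λ y → ∑ xs (λ x → f x y))
∑-comm []       ys f = sym (∑-0 ys)
∑-comm (x ∷ xs) ys f = trans (cong (_+_ (∑ ys (f x))) (∑-comm xs ys f)) (sym (∑-+ ys (f x) _))

onlyIf : Bool → ℤ → ℤ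
onlyIf b x = if b then x else 0ℤ

onlyIf-0 : ∀ b → onlyIf b 0ℤ ≡ 0ℤ
onlyIf-0 true  = refl
onlyIf-0 false = refl

onlyIf-linear : ∀ b c x y → onlyIf b (c * x + y) ≡ c * onlyIf b x + onlyIf b y
onlyIf-linear true  c x y = refl
onlyIf-linear false c x y = sym (trans (ℤ.+-identityʳ (c * 0ℤ)) (ℤ.*-zeroʳ c))

onlyIf-∧ : ∀ b c x → onlyIf (b ∧ c) x ≡ onlyIf c (onlyIf b x)
onlyIf-∧ true  c     x = refl
onlyIf-∧ false true  x = refl
onlyIf-∧ false false x = refl

∑-onlyIf : ∀ (xs : List A) b (f : A → ℤ) → ∑ xs (λ x → onlyIf b (f x)) ≡ onlyIf b (∑ xs f)
∑-onlyIf xs true  f = refl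
∑-onlyIf xs false f = ∑-0 xs

length-filter : ∀ {P : A → Set} (P? : Decidable P) (xs : List A) →
                + length (filter P? xs) ≡ ∑ xs (λ x → onlyIf (does (P? x)) (+ 1))
length-filter P? []       = refl
length-filter P? (x ∷ xs) with does (P? x)
... | true  = cong (_+_ (+ 1)) (length-filter P? xs)
... | false = trans (length-filter P? xs) (sym (ℤ.+-identityˡ _))

sumTo-suc : ∀ (h : ℕ → ℤ) n → sumTo h (suc n) ≡ h 0 + sumTo (λ i → h (suc i)) n
sumTo-suc h zero    = refl
sumTo-suc h (suc n) = trans (cong (_+ h (suc (suc n))) (sumTo-suc h n)) (ℤ.+-assoc (h 0) _ _)

sumTo-cong : ∀ {g h : ℕ → ℤ} → (∀ i → g i ≡ h i) → ∀ n → sumTo g n ≡ sumTo h n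
sumTo-cong g≗h zero    = g≗h 0
sumTo-cong g≗h (suc n) = cong₂ _+_ (sumTo-cong g≗h n) (g≗h (suc n))

sumTo-0 : ∀ n → sumTo (λ _ → 0ℤ) n ≡ 0ℤ
sumTo-0 zero    = refl
sumTo-0 (suc n) = cong (_+ 0ℤ) (sumTo-0 n)

poly-[]-⋆ : ∀ g → poly [] ⋆ g ≈ₛ λ _ → 0ℤ
poly-[]-⋆ g = sumTo-0

poly-∷-⋆-suc : ∀ c cs g n → (poly (c ∷ cs) ⋆ g) (suc n) ≡ c * g (suc n) + (poly cs ⋆ g) n
poly-∷-⋆-suc c cs g n = sumTo-suc (λ i → poly (c ∷ cs) i * g (suc n ∸ i)) n

poly-beyond : ∀ p {n} → length p ≤ n → poly p n ≡ 0ℤ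
poly-beyond []       _             = refl
poly-beyond (c ∷ cs) (ℕ.s≤s p≤n) = poly-beyond cs p≤n

⋆-congʳ : ∀ {f g : FPS} (h : FPS) → f ≈ₛ g → f ⋆ h ≈ₛ g ⋆ h
⋆-congʳ h f≈g n = sumTo-cong (λ i → cong (_* h (n ∸ i)) (f≈g i)) n

infixl 6 _+ₚ_
_+ₚ_ : List ℤ → List ℤ → List ℤ
[]       +ₚ q        = q
(a ∷ p) +ₚ []       = a ∷ p
(a ∷ p) +ₚ (b ∷ q) = a + b ∷ p +ₚ q

infixl 7 _*ₚ_
_*ₚ_ : List ℤ → List ℤ → List ℤ
[]      *ₚ q = []
(c ∷ p) *ₚ q = map (c *_) q +ₚ (0ℤ ∷ p *ₚ q)

poly-+ₚ : ∀ p q n → poly (p +ₚ q) n ≡ poly p n + poly q n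
poly-+ₚ []      q       n       = sym (ℤ.+-identityˡ _)
poly-+ₚ (a ∷ p) []      n       = sym (ℤ.+-identityʳ _)
poly-+ₚ (a ∷ p) (b ∷ q) zero    = refl
poly-+ₚ (a ∷ p) (b ∷ q) (suc n) = poly-+ₚ p q n

poly-map-* : ∀ c q n → poly (map (c *_) q) n ≡ c * poly q n
poly-map-* c []      n       = sym (ℤ.*-zeroʳ c)
poly-map-* c (b ∷ q) zero    = refl
poly-map-* c (b ∷ q) (suc n) = poly-map-* c q n

poly-*ₚ-∷ : ∀ c p q n → poly ((c ∷ p) *ₚ q) n ≡ c * poly q n + poly (0ℤ ∷ p *ₚ q) n
poly-*ₚ-∷ c p q n = trans (poly-+ₚ (map (c *_) q) _ n) (cong (_+ _) (poly-map-* c q n))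

poly-⋆-poly : ∀ p q → poly p ⋆ poly q ≈ₛ poly (p *ₚ q)
poly-⋆-poly []      q n       = poly-[]-⋆ (poly q) n
poly-⋆-poly (c ∷ p) q zero    = sym (trans (poly-*ₚ-∷ c p q 0) (ℤ.+-identityʳ _))
poly-⋆-poly (c ∷ p) q (suc n) = begin
  (poly (c ∷ p) ⋆ poly q) (suc n)          ≡⟨ poly-∷-⋆-suc c p (poly q) n ⟩
  c * poly q (suc n) + (poly p ⋆ poly q) n ≡⟨ cong (_+_ (c * poly q (suc n))) (poly-⋆-poly p q n) ⟩
  c * poly q (suc n) + poly (p *ₚ q) n     ≡⟨ poly-*ₚ-∷ c p q (suc n) ⟨
  poly ((c ∷ p) *ₚ q) (suc n)              ∎
  where open ≡-Reasoning

recurrence : List ℤ → (ℕ → ℤ) → ℕ → ℤ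
recurrence []       g m = 0ℤ
recurrence (c ∷ cs) g m = c * g (length cs ℕ.+ m) + recurrence cs g m

recurrence-cong : ∀ q {g h : ℕ → ℤ} → (∀ n → g n ≡ h n) → ∀ m → recurrence q g m ≡ recurrence q h m
recurrence-cong []       g≗h m = refl
recurrence-cong (c ∷ cs) g≗h m = cong₂ _+_ (cong (c *_) (g≗h _)) (recurrence-cong cs g≗h m)

recurrence-suc : ∀ q (g : ℕ → ℤ) m → recurrence q g (suc m) ≡ recurrence q (λ n → g (suc n)) m
recurrence-suc []       g m = refl
recurrence-suc (c ∷ cs) g m =
  cong₂ _+_ (cong (λ n → c * g n) (ℕ.+-suc (length cs) m)) (recurrence-suc cs g m)

poly-⋆-recurrence : ∀ c cs g m → (poly (c ∷ cs) ⋆ g) (length cs ℕ.+ m) ≡ recurrence (c ∷ cs) g m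
poly-⋆-recurrence c []       g zero    = sym (ℤ.+-identityʳ _)
poly-⋆-recurrence c []       g (suc m) =
  trans (poly-∷-⋆-suc c [] g m) (cong (_+_ (c * g (suc m))) (poly-[]-⋆ g m))
poly-⋆-recurrence c (d ∷ ds) g m =
  trans (poly-∷-⋆-suc c (d ∷ ds) g _) (cong (_+_ (c * g _)) (poly-⋆-recurrence d ds g m))

poly-⋆≈poly : ∀ c cs p (f : FPS) → length p ≤ length cs →
              (∀ m → recurrence (c ∷ cs) f m ≡ 0ℤ) →
              All (λ n → (poly (c ∷ cs) ⋆ f) n ≡ poly p n) (upTo (length cs)) →
              poly (c ∷ cs) ⋆ f ≈ₛ poly p
poly-⋆≈poly c cs p f p≤cs rec≡0 initial n with n <? length cs
... | yes n<d = All.lookup initial (∈-upTo⁺ n<d)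
... | no  n≮d = begin
  (poly (c ∷ cs) ⋆ f) n                               ≡⟨ cong (poly (c ∷ cs) ⋆ f) (ℕ.m+[n∸m]≡n d≤n) ⟨
  (poly (c ∷ cs) ⋆ f) (length cs ℕ.+ (n ∸ length cs)) ≡⟨ poly-⋆-recurrence c cs f (n ∸ length cs) ⟩
  recurrence (c ∷ cs) f (n ∸ length cs)               ≡⟨ rec≡0 (n ∸ length cs) ⟩
  0ℤ                                                  ≡⟨ poly-beyond p (ℕ.≤-trans p≤cs d≤n) ⟨
  poly p n                                            ∎
  where
  open ≡-Reasoning
  d≤n : length cs ≤ n
  d≤n = ℕ.≮⇒≥ n≮d

module LinearOperator {S : Set} (T : (S → ℤ) → S → ℤ)
  (T-cong   : ∀ {g h} → (∀ s → g s ≡ h s) → ∀ s → T g s ≡ T h s)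
  (T-0      : ∀ s → T (λ _ → 0ℤ) s ≡ 0ℤ)
  (T-linear : ∀ c g h s → T (λ t → c * g t + h t) s ≡ c * T g s + T h s)
  where

  recurrence-T : ∀ q (H : ℕ → S → ℤ) m s →
                 recurrence q (λ n → T (H n) s) m ≡ T (λ t → recurrence q (λ n → H n t) m) s
  recurrence-T []       H m s = sym (T-0 s)
  recurrence-T (c ∷ cs) H m s =
    trans (cong (_+_ (c * T (H _) s)) (recurrence-T cs H m s)) (sym (T-linear c (H _) _ s))

  orbit : (S → ℤ) → S → ℕ → ℤ
  orbit v s n = fold v T n s

  recurrence-orbit-suc : ∀ q v m s →
    recurrence q (orbit v s) (suc m) ≡ T (λ t → recurrence q (orbit v t) m) s
  recurrence-orbit-suc q v m s =
    trans (recurrence-suc q (orbit v s) m) (recurrence-T q (fold v T) m s)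

  recurrence-orbit-constant : ∀ q v → (∀ s → recurrence q (orbit v s) 1 ≡ recurrence q (orbit v s) 0) →
                              ∀ m s → recurrence q (orbit v s) m ≡ recurrence q (orbit v s) 0
  recurrence-orbit-constant q v fixed zero    s = refl
  recurrence-orbit-constant q v fixed (suc m) s = begin
    recurrence q (orbit v s) (suc m)               ≡⟨ recurrence-orbit-suc q v m s ⟩
    T (λ t → recurrence q (orbit v t) m) s         ≡⟨ T-cong (recurrence-orbit-constant q v fixed m) s ⟩
    T (λ t → recurrence q (orbit v t) 0) s         ≡⟨ recurrence-orbit-suc q v 0 s ⟨
    recurrence q (orbit v s) 1                     ≡⟨ fixed s ⟩
    recurrence q (orbit v s) 0                     ∎
    where open ≡-Reasoning

letters : Word k n → Subset k
letters []      = ∅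
letters (b ∷ w) = ⁅ b ⁆ ∪ letters w

∈-letters⁺ : ∀ (w : Word k n) p → lookup w p ∈ letters w
∈-letters⁺ (b ∷ w) Fin.zero    = p⊆p∪q (letters w) (x∈⁅x⁆ b)
∈-letters⁺ (b ∷ w) (Fin.suc p) = q⊆p∪q ⁅ b ⁆ (letters w) (∈-letters⁺ w p)

∈-letters⁻ : ∀ (w : Word k n) {c} → c ∈ letters w → ∃[ p ] lookup w p ≡ c
∈-letters⁻ []      c∈∅ = ⊥-elim (∉⊥ c∈∅)
∈-letters⁻ (b ∷ w) c∈ with x∈p∪q⁻ ⁅ b ⁆ (letters w) c∈
... | inj₁ c∈⁅b⁆ = Fin.zero , sym (x∈⁅y⁆⇒x≡y b c∈⁅b⁆)
... | inj₂ c∈w   = let p , wp≡c = ∈-letters⁻ w c∈w in Fin.suc p , wp≡c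

State : ℕ → Set
State k = Maybe (Fin k × Subset k)

state : Word k n → State k
state []      = nothing
state (b ∷ w) = just (b , letters w)

push : Fin k → State k → State k
push a nothing        = just (a , ∅)
push a (just (b , S)) = just (a , ⁅ b ⁆ ∪ S)

state-∷ : ∀ a (w : Word k n) → state (a ∷ w) ≡ push a (state w)
state-∷ a []      = refl
state-∷ a (b ∷ w) = refl

Blocked : Fin k → State k → Set
Blocked a nothing        = ⊥
Blocked a (just (b , S)) = ∃[ c ] c ∈ S × a Fin.< c × c Fin.< b

blocked? : ∀ a (s : State k) → Dec (Blocked a s)
blocked? a nothing        = no λ ()
blocked? a (just (b , S)) = Fin.any? λ c → c ∈? S ×-dec a Fin.<? c ×-dec c Fin.<? b

occ13-2-∷⁻ : ∀ a (w : Word k n) → Occ13-2 (a ∷ w) → Occ13-2 w ⊎ Blocked a (state w)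
occ13-2-∷⁻ a (b ∷ w) (Fin.zero , Fin.suc Fin.zero , Fin.suc (Fin.suc j) , _ , _ , a<c , c<b) =
  inj₂ (lookup w j , ∈-letters⁺ w j , a<c , c<b)
occ13-2-∷⁻ a (b ∷ w) (Fin.zero , Fin.suc Fin.zero , Fin.suc Fin.zero , _ , ℕ.s≤s () , _)
occ13-2-∷⁻ a (b ∷ w) (Fin.zero , Fin.suc (Fin.suc _) , _ , () , _)
occ13-2-∷⁻ a (b ∷ w) (Fin.suc i , Fin.suc i′ , Fin.suc j , i′≡ , ℕ.s≤s i+1<j , σ) =
  inj₁ (i , i′ , j , ℕ.suc-injective i′≡ , i+1<j , σ)
occ13-2-∷⁻ a (b ∷ w) (Fin.suc _ , Fin.suc _ , Fin.zero , _ , () , _)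
occ13-2-∷⁻ a (b ∷ w) (Fin.suc _ , Fin.zero , _ , () , _)

occ13-2-∷⁺ : ∀ a (w : Word k n) → Occ13-2 w ⊎ Blocked a (state w) → Occ13-2 (a ∷ w)
occ13-2-∷⁺ a w (inj₁ (i , i′ , j , i′≡ , i+1<j , σ)) =
  Fin.suc i , Fin.suc i′ , Fin.suc j , cong suc i′≡ , ℕ.s≤s i+1<j , σ
occ13-2-∷⁺ a (b ∷ w) (inj₂ (c , c∈w , a<c , c<b)) with ∈-letters⁻ w c∈w
... | j , refl =
  Fin.zero , Fin.suc Fin.zero , Fin.suc (Fin.suc j) , refl , ℕ.s≤s (ℕ.s≤s ℕ.z≤n) , a<c , c<b

avoids13-2-∷ : ∀ a (w : Word k n) → Avoids13-2 (a ∷ w) ⇔ (¬ Blocked a (state w) × Avoids13-2 w)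
avoids13-2-∷ a w = mk⇔
  (λ avoid → avoid ∘ occ13-2-∷⁺ a w ∘ inj₂ , avoid ∘ occ13-2-∷⁺ a w ∘ inj₁)
  (λ (free , avoid) → [ avoid , free ] ∘ occ13-2-∷⁻ a w)

does-avoids13-2-∷ : ∀ a (w : Word k n) →
  does (avoids13-2? (a ∷ w)) ≡ not (does (blocked? a (state w))) ∧ does (avoids13-2? w)
does-avoids13-2-∷ a w =
  does-⇔ (avoids13-2-∷ a w) (avoids13-2? (a ∷ w)) (¬? (blocked? a (state w)) ×-dec avoids13-2? w)

all-subsets? : {P : Subset n → Set} → Decidable P → Dec (∀ S → P S)
all-subsets? P? = map′
  (λ ∄¬P S → decidable-stable (P? S) λ ¬PS → ∄¬P (S , ¬PS))
  (λ ∀P (S , ¬PS) → ¬PS (∀P S))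
  (¬? (anySubset? (¬? ∘ P?)))

all-states? : {P : State k → Set} → Decidable P → Dec (∀ s → P s)
all-states? P? = map′
  (λ { (P-nothing , P-just) nothing → P-nothing ; (P-nothing , P-just) (just (b , S)) → P-just b S })
  (λ ∀P → ∀P nothing , λ b S → ∀P (just (b , S)))
  (P? nothing ×-dec Fin.all? λ b → all-subsets? λ S → P? (just (b , S)))

module Transfer (k : ℕ) where

  T : (State k → ℤ) → State k → ℤ
  T φ s = ∑ (allFin k) λ a → onlyIf (not (does (blocked? a s))) (φ (push a s))

  T-cong : ∀ {φ ψ} → (∀ s → φ s ≡ ψ s) → ∀ s → T φ s ≡ T ψ s
  T-cong φ≗ψ s = ∑-cong (allFin k) λ a → cong (onlyIf _) (φ≗ψ (push a s))

  T-0 : ∀ s → T (λ _ → 0ℤ) s ≡ 0ℤ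
  T-0 s = trans (∑-cong (allFin k) λ a → onlyIf-0 _) (∑-0 (allFin k))

  T-linear : ∀ c φ ψ s → T (λ t → c * φ t + ψ t) s ≡ c * T φ s + T ψ s
  T-linear c φ ψ s = begin
    T (λ t → c * φ t + ψ t) s
      ≡⟨ ∑-cong (allFin k) (λ a → onlyIf-linear _ c _ _) ⟩
    ∑ (allFin k) (λ a → c * onlyIf _ (φ (push a s)) + onlyIf _ (ψ (push a s)))
      ≡⟨ ∑-+ (allFin k) _ _ ⟩
    ∑ (allFin k) (λ a → c * onlyIf _ (φ (push a s))) + T ψ s
      ≡⟨ cong (_+ T ψ s) (∑-*ˡ (allFin k) c _) ⟩
    c * T φ s + T ψ s ∎
    where open ≡-Reasoning

  weight : ℕ → (State k → ℤ) → ℤ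
  weight n φ = ∑ (allWords k n) λ w → onlyIf (does (avoids13-2? w)) (φ (state w))

  weight-suc : ∀ n φ → weight (suc n) φ ≡ weight n (T φ)
  weight-suc n φ = begin
    weight (suc n) φ
      ≡⟨ ∑-concatMap (λ a → map (a ∷_) (allWords k n)) (allFin k) _ ⟩
    ∑ (allFin k) (λ a → ∑ (map (a ∷_) (allWords k n)) _)
      ≡⟨ ∑-cong (allFin k) (λ a → ∑-map (a ∷_) (allWords k n) _) ⟩
    ∑ (allFin k) (λ a → ∑ (allWords k n) λ w → onlyIf (does (avoids13-2? (a ∷ w))) (φ (state (a ∷ w))))
      ≡⟨ ∑-cong (allFin k) (λ a → ∑-cong (allWords k n) (prepend a)) ⟩
    ∑ (allFin k) (λ a → ∑ (allWords k n) λ w → onlyIf (avoids w) (admit a w))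
      ≡⟨ ∑-comm (allFin k) (allWords k n) _ ⟩
    ∑ (allWords k n) (λ w → ∑ (allFin k) λ a → onlyIf (avoids w) (admit a w))
      ≡⟨ ∑-cong (allWords k n) (λ w → ∑-onlyIf (allFin k) (avoids w) (λ a → admit a w)) ⟩
    weight n (T φ) ∎
    where
    open ≡-Reasoning
    avoids : ∀ {m} → Word k m → Bool
    avoids w = does (avoids13-2? w)
    admit : ∀ {m} → Fin k → Word k m → ℤ
    admit a w = onlyIf (not (does (blocked? a (state w)))) (φ (push a (state w)))
    prepend : ∀ {m} a (w : Word k m) →
              onlyIf (avoids (a ∷ w)) (φ (state (a ∷ w))) ≡ onlyIf (avoids w) (admit a w)
    prepend a w = trans (cong₂ (λ b s → onlyIf b (φ s)) (does-avoids13-2-∷ a w) (state-∷ a w))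
                        (onlyIf-∧ (not (does (blocked? a (state w)))) (avoids w) (φ (push a (state w))))

  weight-iterate : ∀ n φ → weight n φ ≡ iterate T φ n nothing
  weight-iterate zero    φ = ℤ.+-identityʳ (φ nothing)
  weight-iterate (suc n) φ = trans (weight-suc n φ) (weight-iterate n (T φ))

  open LinearOperator T T-cong T-0 T-linear public

  F13-2≡orbit : ∀ n → F13-2 k n ≡ orbit (λ _ → 1ℤ) nothing n
  F13-2≡orbit n = begin
    F13-2 k n                             ≡⟨ length-filter avoids13-2? (allWords k n) ⟩
    weight n (λ _ → 1ℤ)                   ≡⟨ weight-iterate n (λ _ → 1ℤ) ⟩
    iterate T (λ _ → 1ℤ) n nothing        ≡⟨ cong (λ φ → φ nothing) (iterate-is-fold (λ _ → 1ℤ) T n) ⟨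
    orbit (λ _ → 1ℤ) nothing n            ∎
    where open ≡-Reasoning


  recurrence-stable? : ∀ q →
    Dec (∀ s → recurrence q (orbit (λ _ → 1ℤ) s) 1 ≡ recurrence q (orbit (λ _ → 1ℤ) s) 0)
  recurrence-stable? q = all-states? λ s → recurrence q (orbit _ s) 1 ℤ.≟ recurrence q (orbit _ s) 0

  F13-2-rational : ∀ c cs p → length p ℕ.≤ length cs →
                   True (recurrence-stable? (c ∷ cs)) →
                   recurrence (c ∷ cs) (F13-2 k) 0 ≡ 0ℤ →
                   All (λ n → (poly (c ∷ cs) ⋆ F13-2 k) n ≡ poly p n) (upTo (length cs)) →
                   poly (c ∷ cs) ⋆ F13-2 k ≈ₛ poly p
  F13-2-rational c cs p p≤cs stable rec₀≡0 initial =
    poly-⋆≈poly c cs p (F13-2 k) p≤cs rec≡0 initial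
    where
    q : List ℤ
    q = c ∷ cs
    rec≡0 : ∀ m → recurrence q (F13-2 k) m ≡ 0ℤ
    rec≡0 m = begin
      recurrence q (F13-2 k) m                       ≡⟨ recurrence-cong q F13-2≡orbit m ⟩
      recurrence q (orbit (λ _ → 1ℤ) nothing) m      ≡⟨ recurrence-orbit-constant q _ (toWitness stable) m nothing ⟩
      recurrence q (orbit (λ _ → 1ℤ) nothing) 0      ≡⟨ recurrence-cong q F13-2≡orbit 0 ⟨
      recurrence q (F13-2 k) 0                       ≡⟨ rec₀≡0 ⟩
      0ℤ                                             ∎
      where open ≡-Reasoning

module ≈ₛ-Reasoning = Relation.Binary.Reasoning.Setoid (ℕ →-setoid ℤ)

1-x 1-2x 1-3x 1-3x+x² : List ℤ
1-x     = + 1 ∷ - (+ 1) ∷ []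
1-2x    = + 1 ∷ - (+ 2) ∷ []
1-3x    = + 1 ∷ - (+ 3) ∷ []
1-3x+x² = + 1 ∷ - (+ 3) ∷ + 1 ∷ []

F13-2-1 : poly 1-x ⋆ F13-2 1 ≈ₛ poly (+ 1 ∷ [])
F13-2-1 = Transfer.F13-2-rational 1 _ _ _ ℕ.≤-refl _ refl (refl ∷ [])

F13-2-2 : poly 1-2x ⋆ F13-2 2 ≈ₛ poly (+ 1 ∷ [])
F13-2-2 = Transfer.F13-2-rational 2 _ _ _ ℕ.≤-refl _ refl (refl ∷ [])

F13-2-3 : poly 1-2x ⋆ poly 1-3x+x² ⋆ F13-2 3 ≈ₛ poly 1-x ⋆ poly 1-x
F13-2-3 = begin
  poly 1-2x ⋆ poly 1-3x+x² ⋆ F13-2 3 ≈⟨ ⋆-congʳ (F13-2 3) (poly-⋆-poly 1-2x 1-3x+x²) ⟩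
  poly (1-2x *ₚ 1-3x+x²) ⋆ F13-2 3   ≈⟨ Transfer.F13-2-rational 3 _ _ _ ℕ.≤-refl _ refl (refl ∷ refl ∷ refl ∷ []) ⟩
  poly (1-x *ₚ 1-x)                  ≈⟨ poly-⋆-poly 1-x 1-x ⟨
  poly 1-x ⋆ poly 1-x                ∎
  where open ≈ₛ-Reasoning

F13-2-4 : poly 1-3x ⋆ poly 1-2x ⋆ poly 1-3x+x² ⋆ F13-2 4 ≈ₛ poly (+ 1 ∷ - (+ 4) ∷ + 6 ∷ - (+ 3) ∷ [])
F13-2-4 = begin
  poly 1-3x ⋆ poly 1-2x ⋆ poly 1-3x+x² ⋆ F13-2 4
    ≈⟨ ⋆-congʳ (F13-2 4) (⋆-congʳ (poly 1-3x+x²) (poly-⋆-poly 1-3x 1-2x)) ⟩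
  poly (1-3x *ₚ 1-2x) ⋆ poly 1-3x+x² ⋆ F13-2 4
    ≈⟨ ⋆-congʳ (F13-2 4) (poly-⋆-poly (1-3x *ₚ 1-2x) 1-3x+x²) ⟩
  poly (1-3x *ₚ 1-2x *ₚ 1-3x+x²) ⋆ F13-2 4
    ≈⟨ Transfer.F13-2-rational 4 _ _ _ ℕ.≤-refl _ refl (refl ∷ refl ∷ refl ∷ refl ∷ []) ⟩
  poly (+ 1 ∷ - (+ 4) ∷ + 6 ∷ - (+ 3) ∷ []) ∎
  where open ≈ₛ-Reasoning

theorem3p8 :
    (poly (+ 1 ∷ - (+ 1) ∷ []) ⋆ F13-2 1 ≈ₛ poly (+ 1 ∷ []))
    × (poly (+ 1 ∷ - (+ 2) ∷ []) ⋆ F13-2 2 ≈ₛ poly (+ 1 ∷ []))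
    × (poly (+ 1 ∷ - (+ 2) ∷ []) ⋆ poly (+ 1 ∷ - (+ 3) ∷ + 1 ∷ []) ⋆ F13-2 3
        ≈ₛ poly (+ 1 ∷ - (+ 1) ∷ []) ⋆ poly (+ 1 ∷ - (+ 1) ∷ []))
    × (poly (+ 1 ∷ - (+ 3) ∷ []) ⋆ poly (+ 1 ∷ - (+ 2) ∷ []) ⋆ poly (+ 1 ∷ - (+ 3) ∷ + 1 ∷ []) ⋆ F13-2 4
        ≈ₛ poly (+ 1 ∷ - (+ 4) ∷ + 6 ∷ - (+ 3) ∷ []))
theorem3p8 = F13-2-1 , F13-2-2 , F13-2-3 , F13-2-4
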